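{- Let $n>1$ be an even integer and let $k\in\mathbb{Z}$. Then the polynomial $$f_{n,k}(x)=k\sum_{j\geq 0}\binom{n-1}{2j+1}(x^j-x^{j+1})+2\sum_{j\geq 0}\binom{n}{2j}x^j\in\mathbb{Z}[x]$$ is self-reciprocal if and only if $k\in\{0,2\}$.
   Context: Binomial coefficients $\binom{a}{b}$ are $0$ when $b>a$, so the sums are finite. A nonzero polynomial $f(x)$ of (actual) degree $d\ge 0$ is called self-reciprocal if $x^d f(1/x)=f(x)$, i.e. if $f(x)=\sum_{i=0}^d a_ix^i$ with $a_d\neq 0$ then $a_i=a_{d-i}$ for all $0\le i\le d$. Nonzero constant polynomials (degree $0$) count as self-reciprocal. -}

module Defs where

open import Data.Nat as ℕ using (ℕ; zero; suc; _∸_; _≤_; _<_)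
open import Data.Nat.Combinatorics using (_C_)
open import Data.Integer as ℤ using (ℤ; +_; _+_; _-_; _*_)
open import Data.Product using (Σ; _×_)
open import Relation.Binary.PropositionalEquality using (_≡_; _≢_)
open import Relation.Nullary using (¬_)

-- A polynomial in ℤ[x] is represented by its coefficient sequence ℕ → ℤ
-- (coefficient of x^i), required to be eventually zero where relevant.
Poly : Set
Poly = ℕ → ℤ

HasDegree : Poly → ℕ → Set
HasDegree f d = (f d ≢ + 0) × (∀ i → d < i → f i ≡ + 0)

SelfReciprocal : Poly → Set
SelfReciprocal f = Σ ℕ λ d → HasDegree f d × (∀ i → i ≤ d → f i ≡ f (d ∸ i))

-- Coefficient of x^j in  Σ_{j'≥0} C(n-1,2j'+1) (x^{j'} - x^{j'+1}):
--   C(n-1,2j+1) - C(n-1,2j-1)   (second term only for j ≥ 1)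
altPart : ℕ → ℕ → ℤ
altPart n zero    = + ((n ∸ 1) C 1)
altPart n (suc j) = + ((n ∸ 1) C (2 ℕ.* suc j ℕ.+ 1)) - + ((n ∸ 1) C (2 ℕ.* j ℕ.+ 1))

f : ℕ → ℤ → Poly
f n k j = k * altPart n j + + 2 * + (n C (2 ℕ.* j))

-- For n = 2M the coefficients of f_{n,k} vanish beyond x^M, the coefficient of x^M is 2 - k and
-- the constant one is k(n - 1) + 2. So for k ≠ 2 the degree is M, and self-reciprocity forces
-- k(n - 1) + 2 = 2 - k, i.e. k = 0. Conversely f_{n,0} = 2 Σ C(n,2j) x^j and, by Pascal's rule,
-- f_{n,2} = 2 Σ C(n,2j+1) x^j; both are self-reciprocal by the symmetry C(n,i) = C(n,n-i).
module Submission where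

open import Defs
open import Data.Nat using (ℕ; zero; suc; _+_; _*_; _∸_; _≤_; _<_; z≤n; s≤s)
open import Data.Nat.Properties
  using (<-cmp; ≤-pred; ≤-<-trans; <-≤-trans; n≤1+n; m≤m+n; m<m+n; m∸n≤m; m+n∸m≡n; m+[n∸m]≡n;
         *-suc; *-distribˡ-+; *-monoʳ-≤; *-monoʳ-<; +-monoˡ-≤; ∸-monoˡ-≤)
open import Data.Nat.Combinatorics
  using (_C_; k>n⇒nCk≡0; nCk≡nC[n∸k]; nCn≡1; nC1≡n; nCk+nC[k+1]≡[n+1]C[k+1])
import Data.Nat.Tactic.RingSolver as ℕ-Solver
open import Data.Integer using (ℤ; +_)
import Data.Integer as ℤ
import Data.Integer.Properties as ℤ
import Data.Integer.Tactic.RingSolver as ℤ-Solver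
open import Data.Product using (Σ; _,_)
open import Data.Sum using (_⊎_; inj₁; inj₂; [_,_]′)
open import Function using (_∘_)
open import Function.Bundles using (_⇔_; mk⇔)
open import Relation.Binary.Definitions using (tri<; tri≈; tri>)
open import Relation.Binary.PropositionalEquality
  using (_≡_; _≢_; _≗_; refl; sym; trans; cong; subst; module ≡-Reasoning)
open import Relation.Nullary using (yes; no; contradiction)

HasDegree-unique : ∀ {p d e} → HasDegree p d → HasDegree p e → d ≡ e
HasDegree-unique {d = d} {e} (pd≢0 , p>d≡0) (pe≢0 , p>e≡0) with <-cmp d e
... | tri< d<e _ _ = contradiction (p>d≡0 e d<e) pe≢0
... | tri≈ _ d≡e _ = d≡e
... | tri> _ _ e<d = contradiction (p>e≡0 d e<d) pd≢0

SelfReciprocal⇒const≡lead : ∀ {p d} → SelfReciprocal p → HasDegree p d → p 0 ≡ p d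
SelfReciprocal⇒const≡lead {p} (e , deg-e , p-sym) deg-d =
  subst (λ e → p 0 ≡ p e) (HasDegree-unique deg-e deg-d) (p-sym 0 z≤n)

SelfReciprocal-resp : ∀ {p q} → p ≗ q → SelfReciprocal p → SelfReciprocal q
SelfReciprocal-resp p≗q (d , (pd≢0 , p>d≡0) , p-sym) =
  d , ((pd≢0 ∘ trans (p≗q d)) , λ j d<j → trans (sym (p≗q j)) (p>d≡0 j d<j))
    , λ i i≤d → trans (sym (p≗q i)) (trans (p-sym i i≤d) (p≗q (d ∸ i)))

SelfReciprocal-scaleˡ : ∀ c {p} → c ≢ + 0 → SelfReciprocal p → SelfReciprocal (λ j → c ℤ.* p j)
SelfReciprocal-scaleˡ c {p} c≢0 (d , (pd≢0 , p>d≡0) , p-sym) =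
  d , (cpd≢0 , λ j d<j → trans (cong (c ℤ.*_) (p>d≡0 j d<j)) (ℤ.*-zeroʳ c))
    , λ i i≤d → cong (c ℤ.*_) (p-sym i i≤d)
  where
  cpd≢0 : c ℤ.* p d ≢ + 0
  cpd≢0 = [ (λ c≡0 → contradiction c≡0 c≢0) , pd≢0 ]′ ∘ ℤ.i*j≡0⇒i≡0∨j≡0 c

2*[1+m]≡2*m+1+1 : ∀ m → 2 * suc m ≡ 2 * m + 1 + 1
2*[1+m]≡2*m+1+1 = ℕ-Solver.solve-∀

2*[1+m]≡1+[2*m+1] : ∀ m → 2 * suc m ≡ suc (2 * m + 1)
2*[1+m]≡1+[2*m+1] = ℕ-Solver.solve-∀

2*[1+m]+1≡1+2*[1+m] : ∀ m → 2 * suc m + 1 ≡ suc (2 * suc m)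
2*[1+m]+1≡1+2*[1+m] = ℕ-Solver.solve-∀

2*i+1+[2*t+1]≡2*[1+i+t] : ∀ i t → 2 * i + 1 + (2 * t + 1) ≡ 2 * suc (i + t)
2*i+1+[2*t+1]≡2*[1+i+t] = ℕ-Solver.solve-∀

C-reflect : ∀ {n} a b → a + b ≡ n → n C a ≡ n C b
C-reflect a b refl = trans (nCk≡nC[n∸k] (m≤m+n a b)) (cong ((a + b) C_) (m+n∸m≡n a b))

C-pascal : ∀ N {k l} → suc k ≡ l → suc N C l ≡ N C k + N C l
C-pascal N {k} refl = sym (nCk+nC[k+1]≡[n+1]C[k+1] N k)

evenBinomials oddBinomials : ℕ → Poly
evenBinomials n j = + (n C (2 * j))
oddBinomials  n j = + (n C (2 * j + 1))

evenBinomials-selfReciprocal : ∀ M → SelfReciprocal (evenBinomials (2 * M))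
evenBinomials-selfReciprocal M = M , (lead≢0 , vanish) , symmetric
  where
  lead≢0 : evenBinomials (2 * M) M ≢ + 0
  lead≢0 eq with trans (sym (cong +_ (nCn≡1 (2 * M)))) eq
  ... | ()
  vanish : ∀ j → M < j → evenBinomials (2 * M) j ≡ + 0
  vanish j M<j = cong +_ (k>n⇒nCk≡0 (*-monoʳ-< 2 M<j))
  symmetric : ∀ i → i ≤ M → evenBinomials (2 * M) i ≡ evenBinomials (2 * M) (M ∸ i)
  symmetric i i≤M = cong +_ (C-reflect (2 * i) (2 * (M ∸ i))
    (trans (sym (*-distribˡ-+ 2 i (M ∸ i))) (cong (2 *_) (m+[n∸m]≡n i≤M))))

oddBinomials-selfReciprocal : ∀ m → SelfReciprocal (oddBinomials (2 * suc m))
oddBinomials-selfReciprocal m = m , (lead≢0 , vanish) , symmetric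
  where
  n = 2 * suc m
  lead≢0 : oddBinomials n m ≢ + 0
  lead≢0 eq with trans (sym (cong +_ (trans (C-reflect (2 * m + 1) 1 (sym (2*[1+m]≡2*m+1+1 m))) (nC1≡n n)))) eq
  ... | ()
  vanish : ∀ j → m < j → oddBinomials n j ≡ + 0
  vanish j m<j = cong +_ (k>n⇒nCk≡0 (≤-<-trans (*-monoʳ-≤ 2 m<j) (m<m+n (2 * j) (s≤s z≤n))))
  symmetric : ∀ i → i ≤ m → oddBinomials n i ≡ oddBinomials n (m ∸ i)
  symmetric i i≤m = cong +_ (C-reflect (2 * i + 1) (2 * (m ∸ i) + 1)
    (trans (2*i+1+[2*t+1]≡2*[1+i+t] i (m ∸ i)) (cong (λ m → 2 * suc m) (m+[n∸m]≡n i≤m))))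

f-at-0 : ∀ n k → f n k 0 ≡ k ℤ.* + (n ∸ 1) ℤ.+ + 2
f-at-0 n k = cong (λ c → k ℤ.* + c ℤ.+ + 2) (nC1≡n (n ∸ 1))

f-vanishes : ∀ n k j → n < 2 * j → f n k j ≡ + 0
f-vanishes n k (suc j) n<2[1+j] =
  all-zero (k>n⇒nCk≡0 N<2[1+j]+1) (k>n⇒nCk≡0 N<2j+1) (k>n⇒nCk≡0 n<2[1+j])
  where
  all-zero : ∀ {a b c} → a ≡ 0 → b ≡ 0 → c ≡ 0 → k ℤ.* (+ a ℤ.- + b) ℤ.+ + 2 ℤ.* + c ≡ + 0
  all-zero refl refl refl = trans (ℤ.+-identityʳ (k ℤ.* + 0)) (ℤ.*-zeroʳ k)
  N≤2j : n ∸ 1 ≤ 2 * j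
  N≤2j = ∸-monoˡ-≤ 1 (≤-pred (subst (n <_) (*-suc 2 j) n<2[1+j]))
  N<2j+1 : n ∸ 1 < 2 * j + 1
  N<2j+1 = ≤-<-trans N≤2j (m<m+n (2 * j) (s≤s z≤n))
  N<2[1+j]+1 : n ∸ 1 < 2 * suc j + 1
  N<2[1+j]+1 = <-≤-trans N<2j+1 (+-monoˡ-≤ 1 (*-monoʳ-≤ 2 (n≤1+n j)))

f-at-half : ∀ m k → f (2 * suc m) k (suc m) ≡ + 2 ℤ.- k
f-at-half m k = coefficients (k>n⇒nCk≡0 N<2[1+m]+1) N-choose-N (nCn≡1 n)
  where
  n = 2 * suc m
  N<2[1+m]+1 : n ∸ 1 < 2 * suc m + 1
  N<2[1+m]+1 = ≤-<-trans (m∸n≤m n 1) (m<m+n n (s≤s z≤n))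
  N-choose-N : (n ∸ 1) C (2 * m + 1) ≡ 1
  N-choose-N = trans (cong (λ N → N C (2 * m + 1)) (cong (_∸ 1) (2*[1+m]≡1+[2*m+1] m))) (nCn≡1 (2 * m + 1))
  -[1]+2≡2-k : ∀ k → k ℤ.* (+ 0 ℤ.- + 1) ℤ.+ + 2 ℤ.* + 1 ≡ + 2 ℤ.- k
  -[1]+2≡2-k = ℤ-Solver.solve-∀
  coefficients : ∀ {a b c} → a ≡ 0 → b ≡ 1 → c ≡ 1 → k ℤ.* (+ a ℤ.- + b) ℤ.+ + 2 ℤ.* + c ≡ + 2 ℤ.- k
  coefficients refl refl refl = -[1]+2≡2-k k

f[k≡0]≗2*evenBinomials : ∀ n j → f n (+ 0) j ≡ + 2 ℤ.* evenBinomials n j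
f[k≡0]≗2*evenBinomials n j = ℤ.+-identityˡ (+ 2 ℤ.* evenBinomials n j)

altPart+evenBinomials≡oddBinomials : ∀ N j → altPart (suc N) j ℤ.+ evenBinomials (suc N) j ≡ oddBinomials (suc N) j
altPart+evenBinomials≡oddBinomials N zero = begin
  + (N C 1) ℤ.+ + 1   ≡⟨ ℤ.+-comm (+ (N C 1)) (+ 1) ⟩
  + (1 + N C 1)       ≡⟨ cong +_ (C-pascal N {0} refl) ⟨
  + (suc N C 1)       ∎
  where open ≡-Reasoning
altPart+evenBinomials≡oddBinomials N (suc j) = begin
  + a ℤ.- + b ℤ.+ + (suc N C (2 * suc j))   ≡⟨ cong (λ x → + a ℤ.- + b ℤ.+ + x) (C-pascal N (sym (2*[1+m]≡1+[2*m+1] j))) ⟩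
  + a ℤ.- + b ℤ.+ + (b + c)                 ≡⟨ cong (λ x → + a ℤ.- + b ℤ.+ x) (ℤ.pos-+ b c) ⟩
  + a ℤ.- + b ℤ.+ (+ b ℤ.+ + c)             ≡⟨ a-b+[b+c]≡c+a (+ a) (+ b) (+ c) ⟩
  + c ℤ.+ + a                               ≡⟨ ℤ.pos-+ c a ⟨
  + (c + a)                                 ≡⟨ cong +_ (C-pascal N (sym (2*[1+m]+1≡1+2*[1+m] j))) ⟨
  + (suc N C (2 * suc j + 1))               ∎
  where
  open ≡-Reasoning
  a = N C (2 * suc j + 1)
  b = N C (2 * j + 1)
  c = N C (2 * suc j)
  a-b+[b+c]≡c+a : ∀ a b c → a ℤ.- b ℤ.+ (b ℤ.+ c) ≡ c ℤ.+ a
  a-b+[b+c]≡c+a = ℤ-Solver.solve-∀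

f[k≡2]≗2*oddBinomials : ∀ N j → f (suc N) (+ 2) j ≡ + 2 ℤ.* oddBinomials (suc N) j
f[k≡2]≗2*oddBinomials N j = begin
  + 2 ℤ.* altPart (suc N) j ℤ.+ + 2 ℤ.* evenBinomials (suc N) j ≡⟨ ℤ.*-distribˡ-+ (+ 2) (altPart (suc N) j) (evenBinomials (suc N) j) ⟨
  + 2 ℤ.* (altPart (suc N) j ℤ.+ evenBinomials (suc N) j)     ≡⟨ cong (+ 2 ℤ.*_) (altPart+evenBinomials≡oddBinomials N j) ⟩
  + 2 ℤ.* oddBinomials (suc N) j                               ∎
  where open ≡-Reasoning

f-hasDegree : ∀ m k → k ≢ + 2 → HasDegree (f (2 * suc m) k) (suc m)
f-hasDegree m k k≢2 = lead≢0 , λ j m<j → f-vanishes (2 * suc m) k j (*-monoʳ-< 2 m<j)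
  where
  lead≢0 : f (2 * suc m) k (suc m) ≢ + 0
  lead≢0 eq = k≢2 (sym (ℤ.i-j≡0⇒i≡j (+ 2) k (trans (sym (f-at-half m k)) eq)))

const≡2-k⇒k≡0 : ∀ N k → k ℤ.* + N ℤ.+ + 2 ≡ + 2 ℤ.- k → k ≡ + 0
const≡2-k⇒k≡0 N k const≡2-k with ℤ.i*j≡0⇒i≡0∨j≡0 k k*[1+N]≡0
  where
  k*[1+x]≡k*x+2-[2-k] : ∀ k x → k ℤ.* (+ 1 ℤ.+ x) ≡ k ℤ.* x ℤ.+ + 2 ℤ.- (+ 2 ℤ.- k)
  k*[1+x]≡k*x+2-[2-k] = ℤ-Solver.solve-∀
  k*[1+N]≡0 : k ℤ.* + suc N ≡ + 0
  k*[1+N]≡0 = begin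
    k ℤ.* + suc N                       ≡⟨ k*[1+x]≡k*x+2-[2-k] k (+ N) ⟩
    k ℤ.* + N ℤ.+ + 2 ℤ.- (+ 2 ℤ.- k)   ≡⟨ cong (ℤ._- (+ 2 ℤ.- k)) const≡2-k ⟩
    + 2 ℤ.- k ℤ.- (+ 2 ℤ.- k)           ≡⟨ ℤ.+-inverseʳ (+ 2 ℤ.- k) ⟩
    + 0                                 ∎
    where open ≡-Reasoning
... | inj₁ k≡0 = k≡0

SelfReciprocal-f⇒k≡0∨k≡2 : ∀ m k → SelfReciprocal (f (2 * suc m) k) → k ≡ + 0 ⊎ k ≡ + 2
SelfReciprocal-f⇒k≡0∨k≡2 m k sr with k ℤ.≟ + 2
... | yes k≡2 = inj₂ k≡2
... | no  k≢2 = inj₁ (const≡2-k⇒k≡0 (2 * suc m ∸ 1) k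
  (trans (sym (f-at-0 (2 * suc m) k))
  (trans (SelfReciprocal⇒const≡lead sr (f-hasDegree m k k≢2)) (f-at-half m k))))

theorem2p1 : (n : ℕ) → 1 < n → Σ ℕ (λ m → n ≡ 2 * m) → (k : ℤ) →
    SelfReciprocal (f n k) ⇔ (k ≡ + 0 ⊎ k ≡ + 2)
theorem2p1 _ () (zero , refl) _
theorem2p1 _ _ (suc m , refl) k = mk⇔ (SelfReciprocal-f⇒k≡0∨k≡2 m k) λ where
  (inj₁ refl) → SelfReciprocal-resp (sym ∘ f[k≡0]≗2*evenBinomials (2 * suc m))
    (SelfReciprocal-scaleˡ (+ 2) (λ ()) (evenBinomials-selfReciprocal (suc m)))
  (inj₂ refl) → SelfReciprocal-resp (sym ∘ f[k≡2]≗2*oddBinomials _)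
    (SelfReciprocal-scaleˡ (+ 2) (λ ()) (oddBinomials-selfReciprocal m))
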